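{- Let $\pi$ be a pin-permutation of size $n$ written $\pi=\oplus[\pi_1,\dots,\pi_r]$ with $r\ge2$ and each $\pi_i$ $\oplus$-indecomposable, and let $T_1,\dots,T_r$ be the corresponding sets of points of the diagram of $\pi$ (the blocks of $\pi$ occupied by $\pi_1,\dots,\pi_r$). Let $p=(p_1,\dots,p_n)$ be a pin representation of $\pi$ and let $i_0$ be the index such that $p_1\in T_{i_0}$. If $1\le i,j\le r$ satisfy $i<j<i_0$ or $i_0<j<i$, then $T_j$ is read by $p$ entirely before $T_i$, i.e. every pin of $T_j$ appears in $p$ before the first pin of $T_i$.
   Context: For permutations $\pi_1,\dots,\pi_r$, $\oplus[\pi_1,\dots,\pi_r]$ is the permutation whose diagram consists of copies of the diagrams of $\pi_1,\dots,\pi_r$ placed in this order along an increasing diagonal (each copy entirely to the right of and above the previous one). A permutation is $\oplus$-indecomposable if it cannot be written as $\oplus[\tau_1,\dots,\tau_k]$ with $k\ge2$. A pin representation of $\pi$ is a sequence of points $(p_1,\dots,p_n)$, no two on a common horizontal or vertical line, order-isomorphic to the diagram $\{(i,\pi_i)\}$ of $\pi$ (we identify it with the diagram), such that each $p_i$ ($i\ge2$) lies outside the bounding box (smallest axis-parallel rectangle) of $\{p_1,\dots,p_{i-1}\}$ and either separates $p_{i-1}$ from $\{p_1,\dots,p_{i-2}\}$ (the horizontal or vertical line through $p_i$ has them on opposite sides) or does not separate $\{p_1,\dots,p_{i-1}\}$ into two nonempty sets. A pin-permutation is one having a pin representation. -}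

module Defs where

open import Data.Nat using (ℕ; suc; _<_; _≤_)
open import Data.Fin using (Fin; toℕ)
open import Data.Fin.Permutation using (Permutation′; _⟨$⟩ʳ_)
open import Data.Product using (_×_; ∃)
open import Data.Sum using (_⊎_)
open import Relation.Nullary using (¬_)
open import Relation.Binary.PropositionalEquality using (_≡_)

-- Diagram of a permutation π of size n: points (x , π x), x : Fin n,
-- coordinates read as natural numbers (0-based).
value : ∀ {n} → Permutation′ n → Fin n → ℕ
value π x = toℕ (π ⟨$⟩ʳ x)

-- A decomposition π = ⊕[π_1,…,π_r] is given by the block map
-- blk : Fin n → Fin r sending each position x of the diagram to the index
-- of the block T_b containing the point (x , π x).

-- π restricted to block b is of the form ⊕[τ₁,τ₂] with τ₁,τ₂ nonempty:
-- some cut c splits the positions of T_b into a nonempty left part and a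
-- nonempty right part, every left value below every right value.
BlockSplits : ∀ {n r} → Permutation′ n → (Fin n → Fin r) → Fin r → Set
BlockSplits π blk b =
  ∃ λ (c : ℕ) →
    (∃ λ x → blk x ≡ b × toℕ x < c) ×
    (∃ λ y → blk y ≡ b × c ≤ toℕ y) ×
    (∀ x y → blk x ≡ b → blk y ≡ b → toℕ x < c → c ≤ toℕ y →
       value π x < value π y)

record IsOplusDecomposition {n r : ℕ} (π : Permutation′ n)
                            (blk : Fin n → Fin r) : Set where
  field
    monotone   : ∀ x y → toℕ x ≤ toℕ y → toℕ (blk x) ≤ toℕ (blk y)
    nonempty   : ∀ b → ∃ λ x → blk x ≡ b
    increasing : ∀ x y → toℕ (blk x) < toℕ (blk y) → value π x < value π y
    indecomposable : ∀ b → ¬ BlockSplits π blk b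

-- Pin representations.
-- A pin representation is an ordering (p_1,…,p_n) of the diagram points,
-- given by σ : Permutation′ n with p_{k+1} = (σ k , π (σ k)) (0-based k).

module _ {n : ℕ} (X Y : Fin n → ℕ) where

  Before : Fin n → Fin n → Set
  Before k a = toℕ a < toℕ k

  OutsideBox : Fin n → Set
  OutsideBox k =
    (∀ a → Before k a → X a < X k) ⊎ (∀ a → Before k a → X k < X a) ⊎
    (∀ a → Before k a → Y a < Y k) ⊎ (∀ a → Before k a → Y k < Y a)

  SeparatesFrom : Fin n → Fin n → Set
  SeparatesFrom k l =
    (X l < X k × (∀ a → Before l a → X k < X a)) ⊎
    (X k < X l × (∀ a → Before l a → X a < X k)) ⊎
    (Y l < Y k × (∀ a → Before l a → Y k < Y a)) ⊎
    (Y k < Y l × (∀ a → Before l a → Y a < Y k))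

  DoesNotSplit : Fin n → Set
  DoesNotSplit k =
    ((∀ a → Before k a → X a < X k) ⊎ (∀ a → Before k a → X k < X a)) ×
    ((∀ a → Before k a → Y a < Y k) ⊎ (∀ a → Before k a → Y k < Y a))

  PinConditions : Set
  PinConditions = ∀ k l → toℕ k ≡ suc (toℕ l) →
    OutsideBox k × (SeparatesFrom k l ⊎ DoesNotSplit k)

pinX : ∀ {n} → Permutation′ n → Permutation′ n → Fin n → ℕ
pinX π σ k = toℕ (σ ⟨$⟩ʳ k)

pinY : ∀ {n} → Permutation′ n → Permutation′ n → Fin n → ℕ
pinY π σ k = value π (σ ⟨$⟩ʳ k)

IsPinRepresentation : ∀ {n} → Permutation′ n → Permutation′ n → Set
IsPinRepresentation π σ = PinConditions (pinX π σ) (pinY π σ)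

IsPinPermutation : ∀ {n} → Permutation′ n → Set
IsPinPermutation π = ∃ λ σ → IsPinRepresentation π σ

-- If a pin p_a (a > 1) lay in a block strictly between the blocks of an
-- earlier pin p_b and of p_1, then, since the blocks of a ⊕-decomposition
-- increase in both coordinates, p_a would lie strictly inside the bounding
-- box of {p_b, p_1}, contradicting that every pin is read outside the
-- bounding box of its predecessors. Hence T_j, which lies between T_i and
-- T_{i₀}, cannot have any pin read after a pin of T_i.
module Submission where

open import Defs
open import Data.Nat using (ℕ; suc; _<_; _≤_; z≤n)
open import Data.Nat.Properties using (≤⇒≯; ≰⇒>; <-cmp; <-irrefl; <-asym; ≤-<-trans; ≤-reflexive)
open import Data.Fin using (Fin; suc; toℕ; inject₁)
open import Data.Fin.Properties using (toℕ-injective; toℕ-inject₁)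
open import Data.Fin.Permutation using (Permutation′; _⟨$⟩ʳ_)
open import Data.Product using (_×_; _,_; proj₁)
open import Data.Sum using (_⊎_; inj₁; inj₂)
open import Data.Empty using (⊥; ⊥-elim)
open import Relation.Nullary using (¬_)
open import Relation.Binary using (tri<; tri≈; tri>)
open import Relation.Binary.PropositionalEquality using (_≡_; refl; sym; cong)

¬OutsideBox-inside : ∀ {n} (X Y : Fin n → ℕ) {a c d : Fin n} →
  Before X Y a c → Before X Y a d →
  X c < X a → X a < X d → Y c < Y a → Y a < Y d →
  ¬ OutsideBox X Y a
¬OutsideBox-inside X Y c<a d<a xc xd yc yd (inj₁ h) = <-asym xd (h _ d<a)
¬OutsideBox-inside X Y c<a d<a xc xd yc yd (inj₂ (inj₁ h)) = <-asym xc (h _ c<a)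
¬OutsideBox-inside X Y c<a d<a xc xd yc yd (inj₂ (inj₂ (inj₁ h))) = <-asym yd (h _ d<a)
¬OutsideBox-inside X Y c<a d<a xc xd yc yd (inj₂ (inj₂ (inj₂ h))) = <-asym yc (h _ c<a)

PinConditions⇒OutsideBox : ∀ {n} {X Y : Fin n → ℕ} → PinConditions X Y →
  ∀ k → 0 < toℕ k → OutsideBox X Y k
PinConditions⇒OutsideBox pin (suc k) _ =
  proj₁ (pin (suc k) (inject₁ k) (cong suc (sym (toℕ-inject₁ k))))

module _ {n r : ℕ} {π : Permutation′ n} {blk : Fin n → Fin r}
         (D : IsOplusDecomposition π blk) where
  open IsOplusDecomposition D

  block<⇒position< : ∀ {x y} → toℕ (blk x) < toℕ (blk y) → toℕ x < toℕ y
  block<⇒position< {x} {y} lt = ≰⇒> λ y≤x → ≤⇒≯ (monotone y x y≤x) lt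

  pin-¬betweenEarlierBlocks : ∀ σ → IsPinRepresentation π σ → ∀ a c d →
    toℕ c < toℕ a → toℕ d < toℕ a →
    toℕ (blk (σ ⟨$⟩ʳ c)) < toℕ (blk (σ ⟨$⟩ʳ a)) →
    toℕ (blk (σ ⟨$⟩ʳ a)) < toℕ (blk (σ ⟨$⟩ʳ d)) → ⊥
  pin-¬betweenEarlierBlocks σ pin a c d c<a d<a ca ad =
    ¬OutsideBox-inside (pinX π σ) (pinY π σ) c<a d<a
      (block<⇒position< ca) (block<⇒position< ad)
      (increasing _ _ ca) (increasing _ _ ad)
      (PinConditions⇒OutsideBox pin a (≤-<-trans z≤n c<a))

lemmaB3 : ∀ {n r : ℕ} (π : Permutation′ n) (blk : Fin n → Fin r) →
    IsPinPermutation π → 2 ≤ r → IsOplusDecomposition π blk →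
    (σ : Permutation′ n) → IsPinRepresentation π σ →
    (i₀ : Fin r) (k₁ : Fin n) → toℕ k₁ ≡ 0 → blk (σ ⟨$⟩ʳ k₁) ≡ i₀ →
    (i j : Fin r) →
    ((toℕ i < toℕ j × toℕ j < toℕ i₀) ⊎ (toℕ i₀ < toℕ j × toℕ j < toℕ i)) →
    ∀ a b → blk (σ ⟨$⟩ʳ a) ≡ j → blk (σ ⟨$⟩ʳ b) ≡ i → toℕ a < toℕ b
lemmaB3 π blk _ _ D σ pin i₀ k₁ k₁≡0 refl i j ord a b refl refl
  with <-cmp (toℕ a) (toℕ b)
... | tri< a<b _ _ = a<b
... | tri≈ _ a≡b _ with toℕ-injective a≡b | ord
...   | refl | inj₁ (i<j , _) = ⊥-elim (<-irrefl refl i<j)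
...   | refl | inj₂ (_ , j<i) = ⊥-elim (<-irrefl refl j<i)
lemmaB3 π blk _ _ D σ pin i₀ k₁ k₁≡0 refl i j ord a b refl refl
    | tri> _ _ b<a = ⊥-elim (a-between ord)
  where
  k₁<a : toℕ k₁ < toℕ a
  k₁<a = ≤-<-trans (≤-reflexive k₁≡0) (≤-<-trans z≤n b<a)

  a-between : (toℕ i < toℕ j × toℕ j < toℕ i₀) ⊎ (toℕ i₀ < toℕ j × toℕ j < toℕ i) → ⊥
  a-between (inj₁ (i<j , j<i₀)) = pin-¬betweenEarlierBlocks D σ pin a b k₁ b<a k₁<a i<j j<i₀
  a-between (inj₂ (i₀<j , j<i)) = pin-¬betweenEarlierBlocks D σ pin a k₁ b k₁<a b<a i₀<j j<i
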